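{- In the edge-distinguishing game (EDGe) played on the path $P_3$ (with $\lambda(P_3)$ colors), Player 1 has a winning strategy.
   Context: $P_n$ is the path on $n$ vertices. For a positive integer $k$ let $[k]=\{1,\dots,k\}$. A $k$-coloring $c:V(G)\to[k]$ induces $c'(\{u,v\})=\{c(u),c(v)\}$ (a multiset); $c$ is edge-distinguishing if $c'$ is injective, and $\lambda(G)$ is the least $k$ admitting such a coloring. A partial coloring on $U\subseteq V(G)$ has partial induced edge coloring on $G[U]$. EDGe on $G$: two players, Player 1 first, alternately color an uncolored vertex with a color from $[\lambda(G)]$; a move is legal iff afterwards the partial induced edge coloring of the colored vertices is injective. The player making the last legal move wins. A winning strategy guarantees a win regardless of the opponent's play. -}

module Defs where

open import Data.Nat using (ℕ; _+_; _<_)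
open import Data.Fin using (Fin; toℕ; _≟_)
open import Data.Maybe using (Maybe; just; nothing)
open import Data.Product using (Σ; _×_; ∃)
open import Data.Sum using (_⊎_)
open import Relation.Nullary using (¬_; yes; no)
open import Relation.Binary.PropositionalEquality using (_≡_)

record Graph : Set₁ where
  field
    n   : ℕ
    Adj : Fin n → Fin n → Set
open Graph public

P3 : Graph
P3 = record { n = 3 ; Adj = λ i j → (toℕ i + 1 ≡ toℕ j) ⊎ (toℕ j + 1 ≡ toℕ i) }

MSetEq : {A : Set} → A → A → A → A → Set
MSetEq a b c d = (a ≡ c × b ≡ d) ⊎ (a ≡ d × b ≡ c)

SameEdge : {A : Set} → A → A → A → A → Set
SameEdge = MSetEq

EdgeDistinguishing : (G : Graph) {k : ℕ} → (Fin (n G) → Fin k) → Set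
EdgeDistinguishing G c =
  ∀ u v x y → Adj G u v → Adj G x y →
  MSetEq (c u) (c v) (c x) (c y) → SameEdge u v x y

IsLambda : Graph → ℕ → Set
IsLambda G k =
  (Σ (Fin (n G) → Fin k) λ c → EdgeDistinguishing G c) ×
  (∀ m → m < k → ¬ (Σ (Fin (n G) → Fin m) λ c → EdgeDistinguishing G c))

-- Partial colorings: nothing = uncolored.
PartialColoring : Graph → ℕ → Set
PartialColoring G k = Fin (n G) → Maybe (Fin k)

PartialInjective : (G : Graph) {k : ℕ} → PartialColoring G k → Set
PartialInjective G {k} c =
  ∀ u v x y (a b a' b' : Fin k) → Adj G u v → Adj G x y →
  c u ≡ just a → c v ≡ just b → c x ≡ just a' → c y ≡ just b' →
  MSetEq a b a' b' → SameEdge u v x y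

setColor : {G : Graph} {k : ℕ} → PartialColoring G k → Fin (n G) → Fin k → PartialColoring G k
setColor c v col w with w ≟ v
... | yes _ = just (col)
... | no _  = c w

LegalMove : (G : Graph) {k : ℕ} → PartialColoring G k → Fin (n G) → Fin k → Set
LegalMove G c v col = (c v ≡ nothing) × PartialInjective G (setColor {G} c v col)

-- Normal play (last legal move wins).
mutual
  data WinPos (G : Graph) (k : ℕ) (c : PartialColoring G k) : Set where
    win : (v : Fin (n G)) (col : Fin k) → LegalMove G c v col →
          LosePos G k (setColor {G} c v col) → WinPos G k c

  data LosePos (G : Graph) (k : ℕ) (c : PartialColoring G k) : Set where
    lose : ((v : Fin (n G)) (col : Fin k) → LegalMove G c v col →
            WinPos G k (setColor {G} c v col)) → LosePos G k c

emptyColoring : (G : Graph) (k : ℕ) → PartialColoring G k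
emptyColoring G k _ = nothing

Player1Wins : Graph → ℕ → Set
Player1Wins G k = WinPos G k (emptyColoring G k)

-- A colouring of P₃ distinguishes its two edges {0,1} and {1,2} exactly when the
-- end vertices get different colours, so λ(P₃) = 2, and a partial colouring is
-- legal unless all three vertices are coloured with equal ends. Player 1 colours
-- the centre; Player 2 must then colour an end, Player 1 gives the other end the
-- other colour, and no uncoloured vertex remains.
{-# OPTIONS --safe #-}
module Submission where

open import Defs
open import Data.Nat using (ℕ; suc; s≤s; z≤n)
open import Data.Fin using (Fin; zero; suc; opposite)
open import Data.Maybe using (Maybe; just; nothing)
open import Data.Maybe.Properties using (just-injective)
open import Data.Product using (Σ; Σ-syntax; _×_; _,_)
open import Data.Sum using (inj₁; inj₂)
open import Data.Empty using (⊥; ⊥-elim)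
open import Relation.Nullary using (¬_)
open import Relation.Binary.PropositionalEquality using (_≡_; _≢_; refl; sym; trans)

MSetEq-sym : {A : Set} {a b c d : A} → MSetEq a b c d → MSetEq c d a b
MSetEq-sym (inj₁ (refl , refl)) = inj₁ (refl , refl)
MSetEq-sym (inj₂ (refl , refl)) = inj₂ (refl , refl)

MSetEq-trans : {A : Set} {a b c d e f : A} →
               MSetEq a b c d → MSetEq c d e f → MSetEq a b e f
MSetEq-trans (inj₁ (refl , refl)) q                    = q
MSetEq-trans (inj₂ (refl , refl)) (inj₁ (refl , refl)) = inj₂ (refl , refl)
MSetEq-trans (inj₂ (refl , refl)) (inj₂ (refl , refl)) = inj₁ (refl , refl)

MSetEq-sharedMiddle⇒ends≡ : {A : Set} {a m b : A} → MSetEq a m m b → a ≡ b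
MSetEq-sharedMiddle⇒ends≡ (inj₁ (refl , refl)) = refl
MSetEq-sharedMiddle⇒ends≡ (inj₂ (a≡b , _))     = a≡b

MSetEq-colours : {A B : Set} (c : A → Maybe B) {u v x y : A} {a b : B} →
                 MSetEq u v x y → c u ≡ just a → c v ≡ just b →
                 Σ[ a′ ∈ B ] Σ[ b′ ∈ B ] c x ≡ just a′ × c y ≡ just b′ × MSetEq a b a′ b′
MSetEq-colours c (inj₁ (refl , refl)) cu cv = _ , _ , cu , cv , inj₁ (refl , refl)
MSetEq-colours c (inj₂ (refl , refl)) cu cv = _ , _ , cv , cu , inj₂ (refl , refl)

v₀ v₁ v₂ : Fin 3
v₀ = zero
v₁ = suc zero
v₂ = suc (suc zero)

data Side : Set where
  left right : Side

lower upper : Side → Fin 3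
lower left  = v₀
lower right = v₁
upper left  = v₁
upper right = v₂

P3-edgeSide : ∀ {u v} → Adj P3 u v → Σ Side λ s → SameEdge u v (lower s) (upper s)
P3-edgeSide {zero}             {suc zero}       _ = left  , inj₁ (refl , refl)
P3-edgeSide {suc zero}         {zero}           _ = left  , inj₂ (refl , refl)
P3-edgeSide {suc zero}         {suc (suc zero)} _ = right , inj₁ (refl , refl)
P3-edgeSide {suc (suc zero)}   {suc zero}       _ = right , inj₂ (refl , refl)
P3-edgeSide {zero}             {zero}           (inj₁ ())
P3-edgeSide {zero}             {zero}           (inj₂ ())
P3-edgeSide {zero}             {suc (suc zero)} (inj₁ ())
P3-edgeSide {zero}             {suc (suc zero)} (inj₂ ())
P3-edgeSide {suc zero}         {suc zero}       (inj₁ ())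
P3-edgeSide {suc zero}         {suc zero}       (inj₂ ())
P3-edgeSide {suc (suc zero)}   {zero}           (inj₁ ())
P3-edgeSide {suc (suc zero)}   {zero}           (inj₂ ())
P3-edgeSide {suc (suc zero)}   {suc (suc zero)} (inj₁ ())
P3-edgeSide {suc (suc zero)}   {suc (suc zero)} (inj₂ ())

EndsDiffer : {k : ℕ} → PartialColoring P3 k → Set
EndsDiffer c = ∀ {a b} → c v₀ ≡ just a → c v₁ ≡ just b → c v₂ ≡ just a → ⊥

P3-leftRight-distinct : ∀ {k} (c : PartialColoring P3 k) → EndsDiffer c →
                        ∀ {u v x y a b a′ b′} → MSetEq u v v₀ v₁ → MSetEq x y v₁ v₂ →
                        c u ≡ just a → c v ≡ just b → c x ≡ just a′ → c y ≡ just b′ →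
                        ¬ MSetEq a b a′ b′
P3-leftRight-distinct c ends≢ uv≈ xy≈ cu cv cx cy ab≈a′b′
  with MSetEq-colours c uv≈ cu cv | MSetEq-colours c xy≈ cx cy
... | p , q , c₀ , c₁ , ab≈pq | q′ , r , c₁′ , c₂ , a′b′≈q′r
  with just-injective (trans (sym c₁) c₁′)
... | refl with MSetEq-sharedMiddle⇒ends≡
                  (MSetEq-trans (MSetEq-sym ab≈pq) (MSetEq-trans ab≈a′b′ a′b′≈q′r))
... | refl = ends≢ c₀ c₁ c₂

P3-partialInjective : ∀ {k} (c : PartialColoring P3 k) →
                      EndsDiffer c → PartialInjective P3 c
P3-partialInjective c ends≢ u v x y a b a′ b′ uv xy cu cv cx cy ab≈a′b′
  with P3-edgeSide uv | P3-edgeSide xy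
... | left  , uv≈ | left  , xy≈ = MSetEq-trans uv≈ (MSetEq-sym xy≈)
... | right , uv≈ | right , xy≈ = MSetEq-trans uv≈ (MSetEq-sym xy≈)
... | left  , uv≈ | right , xy≈ =
  ⊥-elim (P3-leftRight-distinct c ends≢ uv≈ xy≈ cu cv cx cy ab≈a′b′)
... | right , uv≈ | left  , xy≈ =
  ⊥-elim (P3-leftRight-distinct c ends≢ xy≈ uv≈ cx cy cu cv (MSetEq-sym ab≈a′b′))

P3-edgeDistinguishing : ∀ {k} (c : Fin 3 → Fin k) → c v₀ ≢ c v₂ → EdgeDistinguishing P3 c
P3-edgeDistinguishing c c₀≢c₂ u v x y uv xy =
  P3-partialInjective (λ i → just (c i)) ends≢ u v x y _ _ _ _ uv xy refl refl refl refl
  where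
  ends≢ : EndsDiffer (λ i → just (c i))
  ends≢ refl _ c₂≡c₀ = c₀≢c₂ (sym (just-injective c₂≡c₀))

P3-edgeDistinguishing⇒ends≢ : ∀ {k} {c : Fin 3 → Fin k} →
                              EdgeDistinguishing P3 c → c v₀ ≢ c v₂
P3-edgeDistinguishing⇒ends≢ dist c₀≡c₂
  with dist v₀ v₁ v₁ v₂ (inj₁ refl) (inj₁ refl) (inj₂ (c₀≡c₂ , refl))
... | inj₁ (() , _)
... | inj₂ (() , _)

twoColouring : Fin 3 → Fin 2
twoColouring zero          = zero
twoColouring (suc zero)    = zero
twoColouring (suc (suc _)) = suc zero

IsLambda-P3⇒≡2 : ∀ k → IsLambda P3 k → k ≡ 2
IsLambda-P3⇒≡2 0 ((c , _) , _) with c v₀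
... | ()
IsLambda-P3⇒≡2 1 ((c , dist) , _) =
  ⊥-elim (P3-edgeDistinguishing⇒ends≢ dist (Fin1-irrelevant (c v₀) (c v₂)))
  where
  Fin1-irrelevant : (i j : Fin 1) → i ≡ j
  Fin1-irrelevant zero zero = refl
IsLambda-P3⇒≡2 2 _ = refl
IsLambda-P3⇒≡2 (suc (suc (suc k))) (_ , minimal) =
  ⊥-elim (minimal 2 (s≤s (s≤s (s≤s z≤n)))
    (twoColouring , P3-edgeDistinguishing twoColouring λ ()))

allColoured⇒LosePos : ∀ {G k} {c : PartialColoring G k} →
                      (∀ v → c v ≢ nothing) → LosePos G k c
allColoured⇒LosePos coloured = lose λ v _ (uncoloured , _) → ⊥-elim (coloured v uncoloured)

opposite₂≢ : (a : Fin 2) → opposite a ≢ a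
opposite₂≢ zero       ()
opposite₂≢ (suc zero) ()

centreColoured : PartialColoring P3 2
centreColoured = setColor {P3} (emptyColoring P3 2) v₁ zero

replyOppositely : ∀ v a → LegalMove P3 centreColoured v a →
                  WinPos P3 2 (setColor {P3} centreColoured v a)
replyOppositely (suc zero) _ (() , _)
replyOppositely zero a _ =
  win v₂ (opposite a)
      (refl , P3-partialInjective _ λ { refl _ c₂ → opposite₂≢ a (just-injective c₂) })
      (allColoured⇒LosePos λ { zero () ; (suc zero) () ; (suc (suc zero)) () })
replyOppositely (suc (suc zero)) a _ =
  win v₀ (opposite a)
      (refl , P3-partialInjective _ λ { refl _ c₂ → opposite₂≢ a (sym (just-injective c₂)) })
      (allColoured⇒LosePos λ { zero () ; (suc zero) () ; (suc (suc zero)) () })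

player1Wins-P3-2 : Player1Wins P3 2
player1Wins-P3-2 = win v₁ zero (refl , P3-partialInjective _ λ ()) (lose replyOppositely)

theorem3p8 : (k : ℕ) → IsLambda P3 k → Player1Wins P3 k
theorem3p8 k isLambda with IsLambda-P3⇒≡2 k isLambda
... | refl = player1Wins-P3-2
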